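{- Let $\Delta$ be a guarded recursive specification over TSP with sequencing and non-acceptance. For every process expression $p$ there exist a natural number $n$, actions $a_1,\dots,a_n\in\mathit{Act}\cup\{\tau\}$ and process expressions $p_1,\dots,p_n$ such that either the equation $p=\sum_{i=1}^n a_i.p_i$ or the equation $p = 1+\sum_{i=1}^n a_i.p_i$ is derivable in equational logic from the axioms A1–A3, A5–A13, NA1–NA4 together with the equations $X=\Delta(X)$ ($X\in\mathcal{P}$).
   Context: Fix a set $\mathit{Act}$ of actions, $\tau\notin\mathit{Act}$, and a finite set $\mathcal{P}$ of process identifiers. Process expressions are generated by $p ::= 0 \mid 1 \mid a.p \mid p+p \mid p; p \mid \mathit{NA}(p) \mid X$ with $a\in\mathit{Act}\cup\{\tau\}$, $X\in\mathcal{P}$ ($;$ is the sequencing operator, $\mathit{NA}$ the non-acceptance operator). A recursive specification $\Delta$ assigns to every $X\in\mathcal{P}$ an expression $\Delta(X)$; it is guarded if every occurrence of a process identifier in each right-hand side lies within the scope of an action prefix $a.\_$. For a sequence $p_1,\dots,p_n$, $\sum_{i=1}^n p_i$ is $0$ if $n=0$ and $(\sum_{i=1}^{n-1}p_i)+p_n$ if $n>0$. Axioms (with $x,y,z$ variables and $a\in\mathit{Act}\cup\{\tau\}$): A1 $x+y=y+x$; A2 $x+(y+z)=(x+y)+z$; A3 $x+x=x$; A5 $(x;y);z=x;(y;z)$; A6 $x+0=x$; A7 $0;x=0$; A8 $x;1=x$; A9 $1;x=x$; A10 $(a.x);y=a.(x;y)$; NA1 $\mathit{NA}(0)=0$; NA2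 $\mathit{NA}(1)=0$; NA3 $\mathit{NA}(a.x)=a.x$; NA4 $\mathit{NA}(x+y)=\mathit{NA}(x)+\mathit{NA}(y)$; A11 $\mathit{NA}(x+y);z=\mathit{NA}(x);z+\mathit{NA}(y);z$; A12 $(a.x+y+1);\mathit{NA}(z)=(a.x+y);\mathit{NA}(z)$; A13 $(a.x+y+1);(z+1)=(a.x+y);(z+1)+1$. -}

module Defs where

open import Data.Nat using (ℕ; zero; suc)
open import Data.Fin using (Fin; inject₁; fromℕ)

data Label (Act : Set) : Set where
  act : Act → Label Act
  τ   : Label Act

module _ (Act : Set) (k : ℕ) where
  infixr 30 _∙_
  infixl 20 _⊕_
  infixl 25 _⨾_
  data Proc : Set where
    𝟘   : Proc
    𝟙   : Proc
    _∙_ : Label Act → Proc → Proc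
    _⊕_ : Proc → Proc → Proc
    _⨾_ : Proc → Proc → Proc
    NA  : Proc → Proc
    var : Fin k → Proc

module _ {Act : Set} {k : ℕ} where

  RecSpec : Set
  RecSpec = Fin k → Proc Act k

  -- Every identifier occurrence lies within the scope of an action prefix.
  data GuardedExpr : Proc Act k → Set where
    g𝟘  : GuardedExpr 𝟘
    g𝟙  : GuardedExpr 𝟙
    g∙  : ∀ a p → GuardedExpr (a ∙ p)
    g⊕  : ∀ {p q} → GuardedExpr p → GuardedExpr q → GuardedExpr (p ⊕ q)
    g⨾  : ∀ {p q} → GuardedExpr p → GuardedExpr q → GuardedExpr (p ⨾ q)
    gNA : ∀ {p} → GuardedExpr p → GuardedExpr (NA p)

  Guarded : RecSpec → Set
  Guarded Δ = ∀ X → GuardedExpr (Δ X)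

  ∑ : (n : ℕ) → (Fin n → Proc Act k) → Proc Act k
  ∑ zero    f = 𝟘
  ∑ (suc n) f = ∑ n (λ i → f (inject₁ i)) ⊕ f (fromℕ n)

  -- Equational-logic derivability from A1–A3, A5–A13, NA1–NA4 and
  -- X = Δ(X), for (closed) process expressions: all substitution
  -- instances of axioms, closed under equivalence and congruence.
  infix 4 _⊢_≈_
  data _⊢_≈_ (Δ : RecSpec) : Proc Act k → Proc Act k → Set where
    refl  : ∀ {p} → Δ ⊢ p ≈ p
    sym   : ∀ {p q} → Δ ⊢ p ≈ q → Δ ⊢ q ≈ p
    trans : ∀ {p q r} → Δ ⊢ p ≈ q → Δ ⊢ q ≈ r → Δ ⊢ p ≈ r
    cong∙ : ∀ a {p q} → Δ ⊢ p ≈ q → Δ ⊢ a ∙ p ≈ a ∙ q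
    cong⊕ : ∀ {p p′ q q′} → Δ ⊢ p ≈ p′ → Δ ⊢ q ≈ q′ → Δ ⊢ p ⊕ q ≈ p′ ⊕ q′
    cong⨾ : ∀ {p p′ q q′} → Δ ⊢ p ≈ p′ → Δ ⊢ q ≈ q′ → Δ ⊢ p ⨾ q ≈ p′ ⨾ q′
    congNA : ∀ {p q} → Δ ⊢ p ≈ q → Δ ⊢ NA p ≈ NA q
    rec   : ∀ X → Δ ⊢ var X ≈ Δ X
    A1  : ∀ x y → Δ ⊢ x ⊕ y ≈ y ⊕ x
    A2  : ∀ x y z → Δ ⊢ x ⊕ (y ⊕ z) ≈ (x ⊕ y) ⊕ z
    A3  : ∀ x → Δ ⊢ x ⊕ x ≈ x
    A5  : ∀ x y z → Δ ⊢ (x ⨾ y) ⨾ z ≈ x ⨾ (y ⨾ z)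
    A6  : ∀ x → Δ ⊢ x ⊕ 𝟘 ≈ x
    A7  : ∀ x → Δ ⊢ 𝟘 ⨾ x ≈ 𝟘
    A8  : ∀ x → Δ ⊢ x ⨾ 𝟙 ≈ x
    A9  : ∀ x → Δ ⊢ 𝟙 ⨾ x ≈ x
    A10 : ∀ a x y → Δ ⊢ (a ∙ x) ⨾ y ≈ a ∙ (x ⨾ y)
    NA1 : Δ ⊢ NA 𝟘 ≈ 𝟘
    NA2 : Δ ⊢ NA 𝟙 ≈ 𝟘
    NA3 : ∀ a x → Δ ⊢ NA (a ∙ x) ≈ a ∙ x
    NA4 : ∀ x y → Δ ⊢ NA (x ⊕ y) ≈ NA x ⊕ NA y
    A11 : ∀ x y z → Δ ⊢ NA (x ⊕ y) ⨾ z ≈ (NA x ⨾ z) ⊕ (NA y ⨾ z)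
    A12 : ∀ a x y z → Δ ⊢ ((a ∙ x) ⊕ y ⊕ 𝟙) ⨾ NA z ≈ ((a ∙ x) ⊕ y) ⨾ NA z
    A13 : ∀ a x y z → Δ ⊢ ((a ∙ x) ⊕ y ⊕ 𝟙) ⨾ (z ⊕ 𝟙) ≈ (((a ∙ x) ⊕ y) ⨾ (z ⊕ 𝟙)) ⊕ 𝟙

{-# OPTIONS --safe #-}
module Submission where

-- Head normal forms ⟪ b , l ⟫ (an optional 𝟙 plus a sum of action prefixes)
-- are closed under +, ; and NA.  Sequencing distributes over + only under NA
-- (A11), but a sum of prefixes is its own NA-image, so prefix sums can be
-- sequenced summand by summand; A9, A12 and A13 dispose of a leading 𝟙.  An
-- identifier is unfolded once to its guarded body, which is normalised by
-- induction on the guardedness derivation without looking under prefixes, so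
-- no unbounded unfolding occurs.

open import Defs
open import Data.Nat using (ℕ; suc; zero)
open import Data.Fin using (Fin)
import Data.Fin as Fin
open import Data.Product using (Σ; _×_; _,_; proj₁; proj₂; uncurry)
open import Data.Sum using (_⊎_; inj₁; inj₂)
open import Data.Bool using (Bool; true; false; _∨_)
open import Data.List using (List; []; _∷_; _++_; length; lookup; map)
open import Relation.Binary.Bundles using (Setoid)
import Relation.Binary.Reasoning.Setoid as SetoidReasoning
open import Function using (_∘_)
open import Level using (0ℓ)

module HeadNormalForm {Act : Set} {k : ℕ} (Δ : RecSpec {Act} {k}) where

  Expr : Set
  Expr = Proc Act k

  infix 4 _≈_
  _≈_ : Expr → Expr → Set
  p ≈ q = Δ ⊢ p ≈ q

  ≈-setoid : Setoid 0ℓ 0ℓ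
  ≈-setoid = record
    { Carrier = Expr
    ; _≈_ = _≈_
    ; isEquivalence = record { refl = refl ; sym = sym ; trans = trans }
    }

  open SetoidReasoning ≈-setoid

  ⊕-identityˡ : ∀ x → 𝟘 ⊕ x ≈ x
  ⊕-identityˡ x = trans (A1 𝟘 x) (A6 x)

  ∑-unfoldˡ : ∀ n (f : Fin (suc n) → Expr) →
              ∑ (suc n) f ≈ f Fin.zero ⊕ ∑ n (λ i → f (Fin.suc i))
  ∑-unfoldˡ zero    f = A1 𝟘 (f Fin.zero)
  ∑-unfoldˡ (suc n) f = trans (cong⊕ (∑-unfoldˡ n (λ i → f (Fin.inject₁ i))) refl)
                              (sym (A2 _ _ _))

  Prefix : Set
  Prefix = Label Act × Expr

  prefix : Prefix → Expr
  prefix = uncurry _∙_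

  sum : List Prefix → Expr
  sum []       = 𝟘
  sum (s ∷ ss) = prefix s ⊕ sum ss

  ⟪_,_⟫ : Bool → List Prefix → Expr
  ⟪ false , ss ⟫ = sum ss
  ⟪ true  , ss ⟫ = 𝟙 ⊕ sum ss

  HasHNF : Expr → Set
  HasHNF p = Σ Bool λ b → Σ (List Prefix) λ ss → p ≈ ⟪ b , ss ⟫

  ∑-lookup : ∀ ss → ∑ (length ss) (λ i → prefix (lookup ss i)) ≈ sum ss
  ∑-lookup []       = refl
  ∑-lookup (s ∷ ss) = trans (∑-unfoldˡ (length ss) (λ i → prefix (lookup (s ∷ ss) i)))
                            (cong⊕ refl (∑-lookup ss))

  sum-++ : ∀ ss ts → sum (ss ++ ts) ≈ sum ss ⊕ sum ts
  sum-++ []       ts = sym (⊕-identityˡ _)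
  sum-++ (s ∷ ss) ts = trans (cong⊕ refl (sum-++ ss ts)) (A2 _ _ _)

  sum-⊕-𝟙 : ∀ ss ts → sum ss ⊕ (𝟙 ⊕ sum ts) ≈ 𝟙 ⊕ sum (ss ++ ts)
  sum-⊕-𝟙 ss ts = begin
    sum ss ⊕ (𝟙 ⊕ sum ts)   ≈⟨ A2 _ _ _ ⟩
    (sum ss ⊕ 𝟙) ⊕ sum ts   ≈⟨ cong⊕ (A1 _ _) refl ⟩
    (𝟙 ⊕ sum ss) ⊕ sum ts   ≈⟨ sym (A2 _ _ _) ⟩
    𝟙 ⊕ (sum ss ⊕ sum ts)   ≈⟨ cong⊕ refl (sym (sum-++ ss ts)) ⟩
    𝟙 ⊕ sum (ss ++ ts)      ∎

  ⟪⟫-⊕ : ∀ b ss c ts → ⟪ b , ss ⟫ ⊕ ⟪ c , ts ⟫ ≈ ⟪ b ∨ c , ss ++ ts ⟫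
  ⟪⟫-⊕ false ss false ts = sym (sum-++ ss ts)
  ⟪⟫-⊕ false ss true  ts = sum-⊕-𝟙 ss ts
  ⟪⟫-⊕ true  ss false ts = trans (sym (A2 _ _ _)) (cong⊕ refl (sym (sum-++ ss ts)))
  ⟪⟫-⊕ true  ss true  ts = begin
    (𝟙 ⊕ sum ss) ⊕ (𝟙 ⊕ sum ts)   ≈⟨ sym (A2 _ _ _) ⟩
    𝟙 ⊕ (sum ss ⊕ (𝟙 ⊕ sum ts))   ≈⟨ cong⊕ refl (sum-⊕-𝟙 ss ts) ⟩
    𝟙 ⊕ (𝟙 ⊕ sum (ss ++ ts))      ≈⟨ A2 _ _ _ ⟩
    (𝟙 ⊕ 𝟙) ⊕ sum (ss ++ ts)      ≈⟨ cong⊕ (A3 𝟙) refl ⟩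
    𝟙 ⊕ sum (ss ++ ts)            ∎

  NA-sum : ∀ ss → NA (sum ss) ≈ sum ss
  NA-sum []             = NA1
  NA-sum ((a , p) ∷ ss) = trans (NA4 _ _) (cong⊕ (NA3 a p) (NA-sum ss))

  NA-⟪⟫ : ∀ b ss → NA ⟪ b , ss ⟫ ≈ sum ss
  NA-⟪⟫ false ss = NA-sum ss
  NA-⟪⟫ true  ss = begin
    NA (𝟙 ⊕ sum ss)        ≈⟨ NA4 _ _ ⟩
    NA 𝟙 ⊕ NA (sum ss)     ≈⟨ cong⊕ NA2 (NA-sum ss) ⟩
    𝟘 ⊕ sum ss             ≈⟨ ⊕-identityˡ _ ⟩
    sum ss                 ∎

  _⨾ˢ_ : List Prefix → Expr → List Prefix
  ss ⨾ˢ z = map (λ (a , p) → (a , p ⨾ z)) ss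

  sum-⨾ : ∀ ss z → sum ss ⨾ z ≈ sum (ss ⨾ˢ z)
  sum-⨾ []             z = A7 z
  sum-⨾ ((a , p) ∷ ss) z = begin
    (a ∙ p ⊕ sum ss) ⨾ z                 ≈⟨ cong⨾ (sym (NA-sum ((a , p) ∷ ss))) refl ⟩
    NA (a ∙ p ⊕ sum ss) ⨾ z              ≈⟨ A11 _ _ _ ⟩
    NA (a ∙ p) ⨾ z ⊕ NA (sum ss) ⨾ z     ≈⟨ cong⊕ (cong⨾ (NA3 a p) refl) (cong⨾ (NA-sum ss) refl) ⟩
    (a ∙ p) ⨾ z ⊕ sum ss ⨾ z             ≈⟨ cong⊕ (A10 a p z) (sum-⨾ ss z) ⟩
    a ∙ (p ⨾ z) ⊕ sum (ss ⨾ˢ z)          ∎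

  HasHNF-⊕ : ∀ {p q} → HasHNF p → HasHNF q → HasHNF (p ⊕ q)
  HasHNF-⊕ (b , ss , p≈) (c , ts , q≈) =
    b ∨ c , ss ++ ts , trans (cong⊕ p≈ q≈) (⟪⟫-⊕ b ss c ts)

  HasHNF-NA : ∀ {p} → HasHNF p → HasHNF (NA p)
  HasHNF-NA (b , ss , p≈) = false , ss , trans (congNA p≈) (NA-⟪⟫ b ss)

  HasHNF-⨾ : ∀ {p q} → HasHNF p → HasHNF q → HasHNF (p ⨾ q)
  HasHNF-⨾ {q = q} (false , ss , p≈) _ =
    false , ss ⨾ˢ q , trans (cong⨾ p≈ refl) (sum-⨾ ss q)
  HasHNF-⨾ {q = q} (true , [] , p≈) (c , ts , q≈) =
    c , ts , trans (cong⨾ (trans p≈ (A6 𝟙)) refl) (trans (A9 q) q≈)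
  HasHNF-⨾ (true , (a , p) ∷ ss , p≈) (false , ts , q≈) =
    false , ((a , p) ∷ ss) ⨾ˢ NA (sum ts) ,
    trans (cong⨾ (trans p≈ (A1 _ _)) (trans q≈ (sym (NA-sum ts))))
          (trans (A12 a p (sum ss) (sum ts)) (sum-⨾ ((a , p) ∷ ss) _))
  HasHNF-⨾ (true , (a , p) ∷ ss , p≈) (true , ts , q≈) =
    true , ((a , p) ∷ ss) ⨾ˢ (sum ts ⊕ 𝟙) ,
    trans (cong⨾ (trans p≈ (A1 _ _)) (trans q≈ (A1 _ _)))
          (trans (A13 a p (sum ss) (sum ts))
                 (trans (A1 _ _) (cong⊕ refl (sum-⨾ ((a , p) ∷ ss) _))))

  guarded⇒HasHNF : ∀ {p} → GuardedExpr p → HasHNF p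
  guarded⇒HasHNF g𝟘       = false , [] , refl
  guarded⇒HasHNF g𝟙       = true , [] , sym (A6 𝟙)
  guarded⇒HasHNF (g∙ a p) = false , (a , p) ∷ [] , sym (A6 _)
  guarded⇒HasHNF (g⊕ g h) = HasHNF-⊕ (guarded⇒HasHNF g) (guarded⇒HasHNF h)
  guarded⇒HasHNF (g⨾ g h) = HasHNF-⨾ (guarded⇒HasHNF g) (guarded⇒HasHNF h)
  guarded⇒HasHNF (gNA g)  = HasHNF-NA (guarded⇒HasHNF g)

  var⇒HasHNF : Guarded Δ → ∀ X → HasHNF (var X)
  var⇒HasHNF G X with guarded⇒HasHNF (G X)
  ... | b , ss , ΔX≈ = b , ss , trans (rec X) ΔX≈

  hasHNF : Guarded Δ → ∀ p → HasHNF p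
  hasHNF G 𝟘       = guarded⇒HasHNF g𝟘
  hasHNF G 𝟙       = guarded⇒HasHNF g𝟙
  hasHNF G (a ∙ p) = guarded⇒HasHNF (g∙ a p)
  hasHNF G (p ⊕ q) = HasHNF-⊕ (hasHNF G p) (hasHNF G q)
  hasHNF G (p ⨾ q) = HasHNF-⨾ (hasHNF G p) (hasHNF G q)
  hasHNF G (NA p)  = HasHNF-NA (hasHNF G p)
  hasHNF G (var X) = var⇒HasHNF G X

  HasHNF⇒∑-form : ∀ {p} → HasHNF p →
    Σ ℕ λ n → Σ (Fin n → Label Act) λ a → Σ (Fin n → Expr) λ ps →
    (p ≈ ∑ n (λ i → a i ∙ ps i)) ⊎ (p ≈ 𝟙 ⊕ ∑ n (λ i → a i ∙ ps i))
  HasHNF⇒∑-form (false , ss , p≈) =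
    length ss , proj₁ ∘ lookup ss , proj₂ ∘ lookup ss , inj₁ (trans p≈ (sym (∑-lookup ss)))
  HasHNF⇒∑-form (true  , ss , p≈) =
    length ss , proj₁ ∘ lookup ss , proj₂ ∘ lookup ss ,
    inj₂ (trans p≈ (cong⊕ refl (sym (∑-lookup ss))))

theorem5p2 : {Act : Set} {k : ℕ} (Δ : RecSpec {Act} {k}) → Guarded Δ →
    (p : Proc Act k) →
    Σ ℕ λ n → Σ (Fin n → Label Act) λ a → Σ (Fin n → Proc Act k) λ ps →
    (Δ ⊢ p ≈ ∑ n (λ i → a i ∙ ps i))
    ⊎ (Δ ⊢ p ≈ 𝟙 ⊕ ∑ n (λ i → a i ∙ ps i))
theorem5p2 Δ G p = HasHNF⇒∑-form (hasHNF G p)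
  where open HeadNormalForm Δ
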